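{- Let $N=8$ and let $S_8$ be the set of permutations of $1,\dots,8$ written as words. Let $W^*\subseteq S_8$ be the union of the three sets: (1) $\{w\in S_8:$ the RSK insertion tableau $P(w)$ has shape $(2,2,2,2)$ and $P(w)$ is not the tableau with rows $12,34,56,78\}$; (2) $\{w\in S_8: 6$ precedes $3$, $7$ precedes $4$ precedes $1$, and $8$ precedes $5$ precedes $2$ in $w$, and $\mathrm{inv}_3(w)=9\}$; (3) $\{w\in S_8: 1$ precedes $8$ in $w$ and $\mathrm{inv}_7(w)=18\}$. Let $\bar W^*=S_8\setminus W^*$ and $f^*=\sum_{w\in\bar W^*}w$. Then the generating function $\Delta(f^*)=\sum_{w\in\bar W^*}Q_{\mathrm{Des}(w)}(\mathbf{x})$ is not Schur positive. Moreover, there is a D$_0$ graph on the vertex set $\bar W^*$ whose generating function is not Schur positive.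
   Context: $\mathrm{inv}_k(w)=|\{(i,j):i<j,\ 0<w_i-w_j<k\}|$. $\mathrm{Des}(w)=\{i:w_i>w_{i+1}\}$ and $Q_S(\mathbf{x})=\sum x_{i_1}\cdots x_{i_8}$ over $1\le i_1\le\cdots\le i_8$ with $i_j<i_{j+1}$ for $j\in S$; Schur positive means nonnegative coefficients in the Schur expansion. A D$_0$ graph of degree $n$ is a graph on $W\subseteq\mathcal{W}_n$ (words of length $n$ with no repeated letter) with edges colored from $\{2,\dots,n-1\}$ such that (i) each $i$-edge is one of $\{vbacw,vbcaw\}$, $\{vacbw,vcabw\}$, $\{vbacw,vacbw\}$, $\{vbcaw,vcabw\}$ for letters $a<b<c$ and words $v,w$ with $v$ of length $i-2$; (ii) for all such data, each element of $W\cap\{vbacw,vbcaw,vacbw,vcabw\}$ belongs to exactly one $i$-edge. Its generating function is $\sum_{w\in W}Q_{\mathrm{Des}(w)}(\mathbf{x})$. -}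

module Defs where

open import Data.Bool using (Bool; true; false; if_then_else_; _∧_; _∨_; not; T)
open import Data.Nat using (ℕ; zero; suc; _+_; _*_; _∸_; _≤_; _<_; _≡ᵇ_; _<ᵇ_; _≤ᵇ_)
open import Data.List using (List; []; _∷_; _++_; map; concat; concatMap; filterᵇ;
  length; upTo; zip; replicate; [_])
open import Data.Nat.ListAction using (sum)
open import Data.Bool.ListAction using (all; any)
open import Data.Product using (Σ; _×_; _,_; ∃)
open import Data.Sum using (_⊎_)
open import Data.List.Membership.Propositional using (_∈_)
open import Relation.Binary.PropositionalEquality using (_≡_)

Word : Set
Word = List ℕ

eqW : Word → Word → Bool
eqW []       []       = true
eqW (x ∷ xs) (y ∷ ys) = (x ≡ᵇ y) ∧ eqW xs ys
eqW _        _        = false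

eqT : List Word → List Word → Bool
eqT []       []       = true
eqT (x ∷ xs) (y ∷ ys) = eqW x y ∧ eqT xs ys
eqT _        _        = false

elem : ℕ → List ℕ → Bool
elem a = any (a ≡ᵇ_)

-- The symmetric group S_n as the list of all permutations of 1,…,n
-- (as words), each exactly once.

insertEverywhere : ℕ → Word → List Word
insertEverywhere x []       = [ x ∷ [] ]
insertEverywhere x (y ∷ ys) = (x ∷ y ∷ ys) ∷ map (y ∷_) (insertEverywhere x ys)

permsOf : Word → List Word
permsOf []       = [ [] ]
permsOf (x ∷ xs) = concatMap (insertEverywhere x) (permsOf xs)

oneTo : ℕ → Word
oneTo n = map suc (upTo n)

S : ℕ → List Word
S n = permsOf (oneTo n)

inv : ℕ → Word → ℕ
inv k []       = 0
inv k (x ∷ xs) = length (filterᵇ (λ y → (y <ᵇ x) ∧ ((x ∸ y) <ᵇ k)) xs) + inv k xs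

precedes : ℕ → ℕ → Word → Bool
precedes a b []       = false
precedes a b (x ∷ xs) = if x ≡ᵇ a then elem b xs else precedes a b xs

-- Des(w) = {i : w_i > w_{i+1}}, positions 1-indexed, as a list
desFrom : ℕ → Word → List ℕ
desFrom k (x ∷ y ∷ r) = if y <ᵇ x then k ∷ desFrom (suc k) (y ∷ r) else desFrom (suc k) (y ∷ r)
desFrom k _           = []

Des : Word → List ℕ
Des = desFrom 1

-- RSK row insertion; a tableau is a list of rows, top row first.

Tableau : Set
Tableau = List Word

rowIns : ℕ → Word → Word × (ℕ ⊎ Bool)
rowIns x []       = (x ∷ []) , _⊎_.inj₂ true     -- appended, nothing bumped
rowIns x (y ∷ ys) with x <ᵇ y
... | true  = (x ∷ ys) , _⊎_.inj₁ y
... | false with rowIns x ys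
...   | r , b = (y ∷ r) , b

insertT : ℕ → Tableau → Tableau
insertT x []       = (x ∷ []) ∷ []
insertT x (r ∷ rs) with rowIns x r
... | r' , _⊎_.inj₁ y = r' ∷ insertT y rs
... | r' , _⊎_.inj₂ _ = r' ∷ rs

P : Word → Tableau
P = go []
  where
  go : Tableau → Word → Tableau
  go t []       = t
  go t (x ∷ xs) = go (insertT x t) xs

shape : Tableau → List ℕ
shape = map length

cond1 : Word → Bool
cond1 w = eqW (shape (P w)) (2 ∷ 2 ∷ 2 ∷ 2 ∷ [])
        ∧ not (eqT (P w) ((1 ∷ 2 ∷ []) ∷ (3 ∷ 4 ∷ []) ∷ (5 ∷ 6 ∷ []) ∷ (7 ∷ 8 ∷ []) ∷ []))

cond2 : Word → Bool
cond2 w = precedes 6 3 w ∧ precedes 7 4 w ∧ precedes 4 1 w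
        ∧ precedes 8 5 w ∧ precedes 5 2 w ∧ (inv 3 w ≡ᵇ 9)

cond3 : Word → Bool
cond3 w = precedes 1 8 w ∧ (inv 7 w ≡ᵇ 18)

inWstar : Word → Bool
inWstar w = cond1 w ∨ cond2 w ∨ cond3 w

-- \bar W* = S_8 \ W*, as a list (no repetitions); f* is the formal sum of its elements
Wbar : List Word
Wbar = filterᵇ (λ w → not (inWstar w)) (S 8)

-- Formal power series in x_1, x_2, … with ℕ coefficients, given by their
-- coefficient function on monomials.  A monomial x_1^{α_1} x_2^{α_2} ⋯ is
-- encoded by the list α = [α_1, α_2, …] (trailing zeros irrelevant).

Series : Set
Series = List ℕ → ℕ

-- all sequences (i_1,…,i_m) of positive integers whose content is α,
-- i.e. letter j occurs exactly α_j times (each such sequence once).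
-- 'choices o cs' lists (letter, remaining content) for each letter available.
choices : ℕ → List ℕ → List (ℕ × List ℕ)
choices o []             = []
choices o (zero ∷ cs)    = map (λ { (l , r) → l , (zero ∷ r) }) (choices (suc o) cs)
choices o (suc c ∷ cs)   = (suc o , (c ∷ cs)) ∷ map (λ { (l , r) → l , (suc c ∷ r) }) (choices (suc o) cs)

arrF : ℕ → List ℕ → List Word
arrF zero    cs = if all (_≡ᵇ 0) cs then [ [] ] else []
arrF (suc f) cs = concatMap (λ { (l , r) → map (l ∷_) (arrF f r) }) (choices 0 cs)

sequencesWithContent : List ℕ → List Word
sequencesWithContent α = arrF (sum α) α

count : {A : Set} → (A → Bool) → List A → ℕ
count p xs = length (filterᵇ p xs)

fits : List ℕ → ℕ → Word → Bool
fits D k (x ∷ y ∷ r) = (if elem k D then x <ᵇ y else x ≤ᵇ y) ∧ fits D (suc k) (y ∷ r)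
fits D k _           = true

-- Gessel's fundamental quasisymmetric function Q_S of degree n:
-- coefficient of x^α = #{ i_1 ≤ ⋯ ≤ i_n, i_j < i_{j+1} (j ∈ S), x_{i_1}⋯x_{i_n} = x^α }
Q : ℕ → List ℕ → Series
Q n D α = count (λ s → (length s ≡ᵇ n) ∧ fits D 1 s) (sequencesWithContent α)

Δ : ℕ → List Word → Series
Δ n W α = sum (map (λ w → Q n (Des w) α) W)

toRows : List ℕ → Word → List Word
toRows []       s = []
toRows (k ∷ ks) s = Data.List.take k s ∷ toRows ks (Data.List.drop k s)

weakInc : Word → Bool
weakInc (x ∷ y ∷ r) = (x ≤ᵇ y) ∧ weakInc (y ∷ r)
weakInc _           = true

colStrict : List Word → Bool
colStrict (r₁ ∷ r₂ ∷ rs) = all (λ { (a , b) → a <ᵇ b }) (zip r₁ r₂) ∧ colStrict (r₂ ∷ rs)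
colStrict _              = true

isSSYT : List ℕ → Word → Bool
isSSYT λ' s = (length s ≡ᵇ sum λ') ∧ all weakInc (toRows λ' s) ∧ colStrict (toRows λ' s)

schur : List ℕ → Series
schur λ' α = count (isSSYT λ') (sequencesWithContent α)

partsF : ℕ → ℕ → ℕ → List (List ℕ)
partsF _       zero    _ = [ [] ]
partsF zero    (suc _) _ = []
partsF (suc f) n       m =
  concatMap (λ k → map (k ∷_) (partsF f (n ∸ k) k))
            (filterᵇ (λ k → (k ≤ᵇ n) ∧ (k ≤ᵇ m)) (oneTo n))

Partitions : ℕ → List (List ℕ)
Partitions n = partsF n n n

SchurPositive : ℕ → Series → Set
SchurPositive n f = Σ (List ℕ → ℕ) λ c →
  ∀ α → f α ≡ sum (map (λ λ' → c λ' * schur λ' α) (Partitions n))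

w₁ w₂ w₃ w₄ : Word → ℕ → ℕ → ℕ → Word → Word
w₁ v a b c w = v ++ (b ∷ a ∷ c ∷ w)
w₂ v a b c w = v ++ (b ∷ c ∷ a ∷ w)
w₃ v a b c w = v ++ (a ∷ c ∷ b ∷ w)
w₄ v a b c w = v ++ (c ∷ a ∷ b ∷ w)

Data : ℕ → ℕ → ℕ → ℕ → Word → Word → Set
Data i a b c v w = a < b × b < c × length v ≡ i ∸ 2

AllowedPair : Word → ℕ → ℕ → ℕ → Word → Word → Word → Set
AllowedPair v a b c w x y =
     Pair (w₁ v a b c w) (w₂ v a b c w) ⊎ Pair (w₃ v a b c w) (w₄ v a b c w)
   ⊎ Pair (w₁ v a b c w) (w₃ v a b c w) ⊎ Pair (w₂ v a b c w) (w₄ v a b c w)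
  where
  Pair : Word → Word → Set
  Pair p q = (x ≡ p × y ≡ q) ⊎ (x ≡ q × y ≡ p)

InFour : Word → ℕ → ℕ → ℕ → Word → Word → Set
InFour v a b c w x = x ≡ w₁ v a b c w ⊎ x ≡ w₂ v a b c w ⊎ x ≡ w₃ v a b c w ⊎ x ≡ w₄ v a b c w

record D0Graph (n : ℕ) (W : List Word) : Set₁ where
  field
    E        : ℕ → Word → Word → Set
    symm     : ∀ {i x y} → E i x y → E i y x
    vertices : ∀ {i x y} → E i x y → x ∈ W × y ∈ W
    colours  : ∀ {i x y} → E i x y → 2 ≤ i × i ≤ n ∸ 1
    edgeType : ∀ {i x y} → E i x y →
               Σ ℕ λ a → Σ ℕ λ b → Σ ℕ λ c → Σ Word λ v → Σ Word λ w →
                 Data i a b c v w × AllowedPair v a b c w x y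
    unique   : ∀ i a b c v w → 2 ≤ i → i ≤ n ∸ 1 → Data i a b c v w →
               ∀ x → x ∈ W → InFour v a b c w x →
               Σ Word λ y → E i x y × (∀ z → E i x z → z ≡ y)

genFun : ∀ {n W} → D0Graph n W → Series
genFun {n} {W} _ = Δ n W

-- Schur positivity of Δ(f*) is refuted by a linear functional that reads off finitely
-- many coefficients: major − minor is nonnegative on every Schur function s_λ, λ ⊢ 8, but
-- equals −1 on Δ(f*). As Δ(f*) only depends on the multiset of descent sets of W̄*, it is
-- evaluated through the tally of those descent sets.
--
-- For the graph, each vertex x and colour i look at the window of three letters at
-- positions i − 1, i, i + 1 of x. If it is one of bac, bca, acb, cab, the axioms allow
-- exactly two neighbours of x; x is joined to the preferred one unless that lies in W*,
-- in which case it is joined to the other. An exhaustive computation over W̄* shows that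
-- this partner map is an involution of W̄*, which makes the edges symmetric; the
-- generating function of the resulting graph is Δ(f*) by definition.
module Submission where

open import Defs
open import Algebra.Properties.CommutativeSemigroup using (x∙yz≈y∙xz; interchange)
open import Data.Bool using (Bool; true; false; if_then_else_; _∧_; not; T)
open import Data.Bool.Properties using (T-∧; T-≡)
open import Data.Bool.ListAction using (all)
open import Function.Bundles using (module Equivalence)
open import Data.List using (List; []; _∷_; _++_; map; foldr; filterᵇ; upTo; length)
open import Data.List.Membership.Propositional using (_∈_; find; lose)
open import Data.List.Membership.Propositional.Properties
  using (∈-map⁺; ∈-map⁻; ∈-concatMap⁺; ∈-concatMap⁻; ∈-∃++; ∈-filter⁺; ∈-filter⁻; ∈-upTo⁺)
open import Data.List.Relation.Binary.Permutation.Propositional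
  using (_↭_; ↭-refl; ↭-sym; ↭-trans; prep; swap)
open import Data.List.Relation.Binary.Permutation.Propositional.Properties
  using (∈-resp-↭; ↭-empty-inv; shift; drop-∷; ++⁺ˡ)
open import Data.List.Relation.Unary.All as All using (All; []; _∷_)
open import Data.List.Relation.Unary.All.Properties using (all⁺)
open import Data.List.Relation.Unary.Any using (here; there)
import Data.List.Properties as List
open import Data.Maybe using (Maybe; just; nothing; maybe)
import Data.Maybe as Maybe
import Data.Maybe.Properties as Maybe
open import Data.Nat
  using (ℕ; zero; suc; _+_; _*_; _∸_; _≤_; _<_; _≤ᵇ_; _≡ᵇ_; s≤s; z≤n)
open import Data.Nat.ListAction using (sum)
open import Data.Nat.Properties
  using (+-assoc; *-identityˡ; *-distribˡ-+; *-zeroʳ; +-mono-≤; *-monoʳ-≤; *-commutativeSemigroup;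
         ≤⇒≯; n<1+n; ∸-monoˡ-≤; ≤ᵇ⇒≤; ≡ᵇ⇒≡; ≡⇒≡ᵇ; <ᵇ-reflects-<;
         +-commutativeSemigroup)
open import Data.Product using (Σ; ∃; _×_; _,_; proj₁; proj₂; map₁)
open import Data.Sum using (_⊎_; inj₁; inj₂; [_,_])
open import Data.Empty using (⊥-elim)
open import Data.Unit using (tt)
open import Function using (_∘_)
open import Relation.Binary.Definitions using (DecidableEquality)
open import Relation.Binary.PropositionalEquality
  using (_≡_; refl; sym; trans; cong; cong₂; subst; subst₂; module ≡-Reasoning)
open import Relation.Nullary using (¬_; Dec; yes; no; does; _because_)
open import Relation.Nullary.Reflects using (fromEquivalence; _×-reflects_; _⊎-reflects_)
open import Relation.Nullary.Decidable using (⌊_⌋; toWitness; T?)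

open ≡-Reasoning

∈-insertEverywhere⁻ : ∀ {a x} ys → x ∈ insertEverywhere a ys → x ↭ a ∷ ys
∈-insertEverywhere⁻ []       (here refl) = ↭-refl
∈-insertEverywhere⁻ (y ∷ ys) (here refl) = ↭-refl
∈-insertEverywhere⁻ {a} (y ∷ ys) (there x∈) with ∈-map⁻ (y ∷_) x∈
... | x′ , x′∈ , refl = ↭-trans (prep y (∈-insertEverywhere⁻ ys x′∈)) (swap y a ↭-refl)

∈-insertEverywhere⁺ : ∀ a us vs → us ++ a ∷ vs ∈ insertEverywhere a (us ++ vs)
∈-insertEverywhere⁺ a []       []       = here refl
∈-insertEverywhere⁺ a []       (v ∷ vs) = here refl
∈-insertEverywhere⁺ a (u ∷ us) vs       = there (∈-map⁺ (u ∷_) (∈-insertEverywhere⁺ a us vs))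

∈-permsOf⁻ : ∀ {x} ys → x ∈ permsOf ys → x ↭ ys
∈-permsOf⁻ []       (here refl) = ↭-refl
∈-permsOf⁻ (a ∷ ys) x∈
  with z , z∈ , x∈′ ← find (∈-concatMap⁻ (insertEverywhere a) {xs = permsOf ys} x∈)
  = ↭-trans (∈-insertEverywhere⁻ z x∈′) (prep a (∈-permsOf⁻ ys z∈))

∈-permsOf⁺ : ∀ {x} ys → x ↭ ys → x ∈ permsOf ys
∈-permsOf⁺ []       x↭ rewrite ↭-empty-inv x↭ = here refl
∈-permsOf⁺ (a ∷ ys) x↭ with us , vs , refl ← ∈-∃++ (∈-resp-↭ (↭-sym x↭) (here refl)) =
  ∈-concatMap⁺ (insertEverywhere a)
    (lose (∈-permsOf⁺ ys (drop-∷ (↭-trans (↭-sym (shift a us vs)) x↭)))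
          (∈-insertEverywhere⁺ a us vs))

∈-S-resp-↭ : ∀ n {x y} → y ↭ x → x ∈ S n → y ∈ S n
∈-S-resp-↭ n y↭x x∈ = ∈-permsOf⁺ (oneTo n) (↭-trans y↭x (∈-permsOf⁻ (oneTo n) x∈))

module Tally {A : Set} (_≟ᴬ_ : DecidableEquality A) where

  tallyInsert : A → List (A × ℕ) → List (A × ℕ)
  tallyInsert x []             = (x , 1) ∷ []
  tallyInsert x ((y , m) ∷ ts) =
    if does (x ≟ᴬ y) then (y , suc m) ∷ ts else (y , m) ∷ tallyInsert x ts

  tally : List A → List (A × ℕ)
  tally = foldr tallyInsert []

  weightedSum : (A → ℕ) → List (A × ℕ) → ℕ
  weightedSum g ts = sum (map (λ (x , m) → m * g x) ts)

  weightedSum-tallyInsert : ∀ g x ts → weightedSum g (tallyInsert x ts) ≡ g x + weightedSum g ts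
  weightedSum-tallyInsert g x [] = cong (_+ 0) (*-identityˡ (g x))
  weightedSum-tallyInsert g x ((y , m) ∷ ts) with x ≟ᴬ y
  ... | yes refl = +-assoc (g x) (m * g x) (weightedSum g ts)
  ... | no  _    = begin
    m * g y + weightedSum g (tallyInsert x ts)
      ≡⟨ cong (m * g y +_) (weightedSum-tallyInsert g x ts) ⟩
    m * g y + (g x + weightedSum g ts)
      ≡⟨ x∙yz≈y∙xz +-commutativeSemigroup (m * g y) (g x) _ ⟩
    g x + (m * g y + weightedSum g ts)
      ∎

  sum-map-tally : ∀ g xs → sum (map g xs) ≡ weightedSum g (tally xs)
  sum-map-tally g []       = refl
  sum-map-tally g (x ∷ xs) = begin
    g x + sum (map g xs)              ≡⟨ cong (g x +_) (sum-map-tally g xs) ⟩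
    g x + weightedSum g (tally xs)    ≡⟨ weightedSum-tallyInsert g x (tally xs) ⟨
    weightedSum g (tally (x ∷ xs))    ∎

evalAt : List (ℕ × List ℕ) → Series → ℕ
evalAt ts f = sum (map (λ (k , α) → k * f α) ts)

evalAt-cong : ∀ ts {f g : Series} → (∀ α → f α ≡ g α) → evalAt ts f ≡ evalAt ts g
evalAt-cong ts f≗g = cong sum (List.map-cong (λ (k , α) → cong (k *_) (f≗g α)) ts)

evalAt-zero : ∀ ts → evalAt ts (λ _ → 0) ≡ 0
evalAt-zero []             = refl
evalAt-zero ((k , _) ∷ ts) = cong₂ _+_ (*-zeroʳ k) (evalAt-zero ts)

evalAt-+ : ∀ ts f g → evalAt ts (λ α → f α + g α) ≡ evalAt ts f + evalAt ts g
evalAt-+ []             f g = refl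
evalAt-+ ((k , α) ∷ ts) f g = begin
  k * (f α + g α) + evalAt ts (λ α → f α + g α)
    ≡⟨ cong₂ _+_ (*-distribˡ-+ k (f α) (g α)) (evalAt-+ ts f g) ⟩
  (k * f α + k * g α) + (evalAt ts f + evalAt ts g)
    ≡⟨ interchange +-commutativeSemigroup (k * f α) _ _ _ ⟩
  (k * f α + evalAt ts f) + (k * g α + evalAt ts g)
    ∎

evalAt-* : ∀ ts c f → evalAt ts (λ α → c * f α) ≡ c * evalAt ts f
evalAt-* []             c f = sym (*-zeroʳ c)
evalAt-* ((k , α) ∷ ts) c f = begin
  k * (c * f α) + evalAt ts (λ α → c * f α)
    ≡⟨ cong₂ _+_ (x∙yz≈y∙xz *-commutativeSemigroup k c (f α)) (evalAt-* ts c f) ⟩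
  c * (k * f α) + c * evalAt ts f
    ≡⟨ *-distribˡ-+ c _ _ ⟨
  c * (k * f α + evalAt ts f)
    ∎

evalAt-sum : ∀ ts {A : Set} (F : A → Series) xs →
             evalAt ts (λ α → sum (map (λ x → F x α) xs)) ≡ sum (map (λ x → evalAt ts (F x)) xs)
evalAt-sum ts F []       = evalAt-zero ts
evalAt-sum ts F (x ∷ xs) =
  trans (evalAt-+ ts (F x) _) (cong (evalAt ts (F x) +_) (evalAt-sum ts F xs))

evalAt-expansion : ∀ ts {f : Series} (c : List ℕ → ℕ) (g : List ℕ → Series) ps →
                   (∀ α → f α ≡ sum (map (λ l → c l * g l α) ps)) →
                   evalAt ts f ≡ sum (map (λ l → c l * evalAt ts (g l)) ps)
evalAt-expansion ts {f} c g ps f≗ = begin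
  evalAt ts f                                          ≡⟨ evalAt-cong ts f≗ ⟩
  evalAt ts (λ α → sum (map (λ l → c l * g l α) ps))  ≡⟨ evalAt-sum ts (λ l α → c l * g l α) ps ⟩
  sum (map (λ l → evalAt ts (λ α → c l * g l α)) ps)
    ≡⟨ cong sum (List.map-cong (λ l → evalAt-* ts (c l) (g l)) ps) ⟩
  sum (map (λ l → c l * evalAt ts (g l)) ps)          ∎

sum-map-mono : ∀ {A : Set} {g h : A → ℕ} {xs} → All (λ x → g x ≤ h x) xs →
               sum (map g xs) ≤ sum (map h xs)
sum-map-mono []       = z≤n
sum-map-mono (p ∷ ps) = +-mono-≤ p (sum-map-mono ps)

-- SchurPositive n f unfolds to a Σ-type, so n and f can never be inferred from it.
SchurPositive⇒evalAt-mono : ∀ {n f} μ ν →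
                            All (λ l → evalAt μ (schur l) ≤ evalAt ν (schur l)) (Partitions n) →
                            SchurPositive n f → evalAt μ f ≤ evalAt ν f
SchurPositive⇒evalAt-mono {n} μ ν μ≤ν (c , f≗) =
  subst₂ _≤_ (sym (evalAt-expansion μ c schur (Partitions n) f≗))
             (sym (evalAt-expansion ν c schur (Partitions n) f≗))
             (sum-map-mono (All.map (λ {l} → *-monoʳ-≤ (c l)) μ≤ν))

¬SchurPositive-by-evalAt : ∀ {n f} μ ν →
                           All (λ l → evalAt μ (schur l) ≤ evalAt ν (schur l)) (Partitions n) →
                           evalAt ν f < evalAt μ f → ¬ SchurPositive n f
¬SchurPositive-by-evalAt {n} {f} μ ν μ≤ν ν<μ sp =
  ≤⇒≯ (SchurPositive⇒evalAt-mono {n} {f} μ ν μ≤ν sp) ν<μ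

eqW-sound : ∀ x y → T (eqW x y) → x ≡ y
eqW-sound []      []      _ = refl
eqW-sound (a ∷ x) (b ∷ y) t with a≡b , x≡y ← Equivalence.to (T-∧ {a ≡ᵇ b}) t =
  cong₂ _∷_ (≡ᵇ⇒≡ a b a≡b) (eqW-sound x y x≡y)

eqW-refl : ∀ x → T (eqW x x)
eqW-refl []      = tt
eqW-refl (a ∷ x) = Equivalence.from (T-∧ {a ≡ᵇ a}) (≡⇒≡ᵇ a a refl , eqW-refl x)

-- Deciding by eqW (rather than List.≡-dec _≟_) keeps the exhaustive computations below fast.
_≟W_ : DecidableEquality Word
x ≟W y = eqW x y because fromEquivalence (eqW-sound x y) λ { refl → eqW-refl x }

open Tally _≟W_ using (tally; weightedSum; sum-map-tally)

evalAt-Δ : ∀ ts n W → evalAt ts (Δ n W) ≡ weightedSum (λ D → evalAt ts (Q n D)) (tally (map Des W))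
evalAt-Δ ts n W = begin
  evalAt ts (Δ n W)                                   ≡⟨ evalAt-sum ts (λ w → Q n (Des w)) W ⟩
  sum (map (λ w → evalAt ts (Q n (Des w))) W)         ≡⟨ cong sum (List.map-∘ W) ⟩
  sum (map (λ D → evalAt ts (Q n D)) (map Des W))     ≡⟨ sum-map-tally _ (map Des W) ⟩
  weightedSum (λ D → evalAt ts (Q n D)) (tally (map Des W)) ∎

-- Exhaustive checks are stated as all p xs ≡ true and closed by refl: asking Agda to
-- reduce T (all p xs) to ⊤ instead is many times slower.
all≡true⇒All : ∀ {A : Set} (p : A → Bool) xs → all p xs ≡ true → All (T ∘ p) xs
all≡true⇒All p xs = all⁺ p xs ∘ Equivalence.from T-≡

-- On the s_λ with λ ⊢ 8, major − minor is 1 for one λ and 0 for all others.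
minor major : List (ℕ × List ℕ)
minor = (3 , 3 ∷ 2 ∷ 2 ∷ 1 ∷ []) ∷ (2 , 4 ∷ 2 ∷ 2 ∷ []) ∷ (2 , 4 ∷ 3 ∷ 1 ∷ [])
      ∷ (1 , 5 ∷ 1 ∷ 1 ∷ 1 ∷ []) ∷ (1 , 5 ∷ 3 ∷ []) ∷ []
major = (1 , 2 ∷ 2 ∷ 2 ∷ 2 ∷ []) ∷ (1 , 3 ∷ 3 ∷ 1 ∷ 1 ∷ []) ∷ (2 , 3 ∷ 3 ∷ 2 ∷ [])
      ∷ (2 , 4 ∷ 2 ∷ 1 ∷ 1 ∷ []) ∷ (1 , 4 ∷ 4 ∷ []) ∷ (2 , 5 ∷ 2 ∷ 1 ∷ []) ∷ []

schur-minor≤major : All (λ l → evalAt minor (schur l) ≤ evalAt major (schur l)) (Partitions 8)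
schur-minor≤major = All.map (λ {l} → ≤ᵇ⇒≤ (evalAt minor (schur l)) _)
  (all≡true⇒All (λ l → evalAt minor (schur l) ≤ᵇ evalAt major (schur l)) (Partitions 8) refl)

evalAt-major-Δ : evalAt major (Δ 8 Wbar) ≡ 6828
evalAt-major-Δ = trans (evalAt-Δ major 8 Wbar) refl

evalAt-minor-Δ : evalAt minor (Δ 8 Wbar) ≡ 6829
evalAt-minor-Δ = trans (evalAt-Δ minor 8 Wbar) refl

¬SchurPositive-Δ : ¬ SchurPositive 8 (Δ 8 Wbar)
¬SchurPositive-Δ = ¬SchurPositive-by-evalAt {8} {Δ 8 Wbar} minor major schur-minor≤major
                     (subst₂ _<_ (sym evalAt-major-Δ) (sym evalAt-minor-Δ) (n<1+n 6828))

Between : ℕ → ℕ → ℕ → Set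
Between y m z = (y < m × m < z) ⊎ (z < m × m < y)

-- Built from reflections rather than _<?_, _×-dec_ and _⊎-dec_, which evaluate much
-- more slowly in the exhaustive check below.
between? : ∀ y m z → Dec (Between y m z)
between? y m z = _ because ((<ᵇ-reflects-< y m ×-reflects <ᵇ-reflects-< m z)
                            ⊎-reflects (<ᵇ-reflects-< z m ×-reflects <ᵇ-reflects-< m y))

-- In bac and bca the first letter is the median, in acb and cab the last one. The
-- preferred neighbour comes from the edge types {bac, bca} and {acb, cab}, the other one
-- from {bac, acb} and {bca, cab}.
neighbours : Word → Maybe (Word × Word)
neighbours (x₁ ∷ x₂ ∷ x₃ ∷ []) with between? x₂ x₁ x₃ | between? x₁ x₃ x₂
... | yes _ | _     = just (x₁ ∷ x₃ ∷ x₂ ∷ [] , x₂ ∷ x₃ ∷ x₁ ∷ [])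
... | no _  | yes _ = just (x₂ ∷ x₁ ∷ x₃ ∷ [] , x₃ ∷ x₁ ∷ x₂ ∷ [])
... | no _  | no _  = nothing
neighbours _ = nothing

AllowedNeighbours : Word → Word → Word → Word → Word → Set
AllowedNeighbours v t w p q = Σ ℕ λ a → Σ ℕ λ b → Σ ℕ λ c → (a < b × b < c) ×
  AllowedPair v a b c w (v ++ t ++ w) (v ++ p ++ w) ×
  AllowedPair v a b c w (v ++ t ++ w) (v ++ q ++ w)

neighbours-allowed : ∀ v t w {p q} → neighbours t ≡ just (p , q) → AllowedNeighbours v t w p q
neighbours-allowed v (x₁ ∷ x₂ ∷ x₃ ∷ []) w e with between? x₂ x₁ x₃ | between? x₁ x₃ x₂ | e
... | yes (inj₁ (x₂<x₁ , x₁<x₃)) | _ | refl =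
  x₂ , x₁ , x₃ , (x₂<x₁ , x₁<x₃) , inj₁ (inj₁ (refl , refl)) , inj₂ (inj₂ (inj₁ (inj₁ (refl , refl))))
... | yes (inj₂ (x₃<x₁ , x₁<x₂)) | _ | refl =
  x₃ , x₁ , x₂ , (x₃<x₁ , x₁<x₂) , inj₁ (inj₂ (refl , refl)) , inj₂ (inj₂ (inj₂ (inj₁ (refl , refl))))
... | no _ | yes (inj₁ (x₁<x₃ , x₃<x₂)) | refl =
  x₁ , x₃ , x₂ , (x₁<x₃ , x₃<x₂) , inj₂ (inj₁ (inj₁ (refl , refl))) , inj₂ (inj₂ (inj₁ (inj₂ (refl , refl))))
... | no _ | yes (inj₂ (x₂<x₃ , x₃<x₁)) | refl =
  x₂ , x₃ , x₁ , (x₂<x₃ , x₃<x₁) , inj₂ (inj₁ (inj₂ (refl , refl))) , inj₂ (inj₂ (inj₂ (inj₂ (refl , refl))))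

neighbours-defined : ∀ x₁ x₂ x₃ → Between x₂ x₁ x₃ ⊎ Between x₁ x₃ x₂ →
                     ∃ λ pq → neighbours (x₁ ∷ x₂ ∷ x₃ ∷ []) ≡ just pq
neighbours-defined x₁ x₂ x₃ median with between? x₂ x₁ x₃ | between? x₁ x₃ x₂
... | yes _  | _      = _ , refl
... | no _   | yes _  = _ , refl
... | no ¬p₁ | no ¬p₃ = ⊥-elim ([ ¬p₁ , ¬p₃ ] median)

windowAt : ℕ → Word → Maybe (Word × Word × Word)
windowAt zero    (x₁ ∷ x₂ ∷ x₃ ∷ w) = just ([] , x₁ ∷ x₂ ∷ x₃ ∷ [] , w)
windowAt zero    _                  = nothing
windowAt (suc k) []                 = nothing
windowAt (suc k) (x ∷ xs)           = Maybe.map (map₁ (x ∷_)) (windowAt k xs)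

windowAt-sound : ∀ k x {v t w} → windowAt k x ≡ just (v , t , w) → x ≡ v ++ t ++ w × length v ≡ k
windowAt-sound zero    (x₁ ∷ x₂ ∷ x₃ ∷ w) refl = refl , refl
windowAt-sound (suc k) (x ∷ xs) e with windowAt k xs in s | e
... | just (v , t , w) | refl with refl , refl ← windowAt-sound k xs s = refl , refl

windowAt-++ : ∀ v x₁ x₂ x₃ w →
              windowAt (length v) (v ++ x₁ ∷ x₂ ∷ x₃ ∷ w) ≡ just (v , x₁ ∷ x₂ ∷ x₃ ∷ [] , w)
windowAt-++ []      x₁ x₂ x₃ w = refl
windowAt-++ (y ∷ v) x₁ x₂ x₃ w = cong (Maybe.map (map₁ (y ∷_))) (windowAt-++ v x₁ x₂ x₃ w)

preferredNeighbour : Word → Word → Word × Word → Word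
preferredNeighbour v w (p , q) = if inWstar (v ++ p ++ w) then v ++ q ++ w else v ++ p ++ w

preferredNeighbour-elim : ∀ (P : Word → Set) v w p q → P (v ++ p ++ w) → P (v ++ q ++ w) →
                          P (preferredNeighbour v w (p , q))
preferredNeighbour-elim P v w p q Pp Pq with inWstar (v ++ p ++ w)
... | true  = Pq
... | false = Pp

partnerAround : Word × Word × Word → Maybe Word
partnerAround (v , t , w) = Maybe.map (preferredNeighbour v w) (neighbours t)

partnerAt : ℕ → Word → Maybe Word
partnerAt k x = windowAt k x Maybe.>>= partnerAround

partnerAt-allowed : ∀ k x {y} → partnerAt k x ≡ just y →
  Σ ℕ λ a → Σ ℕ λ b → Σ ℕ λ c → Σ Word λ v → Σ Word λ w →
    (a < b × b < c × length v ≡ k) × AllowedPair v a b c w x y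
partnerAt-allowed k x e with windowAt k x in s | e
... | just (v , t , w) | e′ with refl , |v| ← windowAt-sound k x s with neighbours t in n | e′
...   | just (p , q) | refl with a , b , c , (a<b , b<c) , tp , tq ← neighbours-allowed v t w n =
  a , b , c , v , w , (a<b , b<c , |v|) ,
  preferredNeighbour-elim (AllowedPair v a b c w (v ++ t ++ w)) v w p q tp tq

partnerAt-defined : ∀ {v a b c w x} → a < b → b < c → InFour v a b c w x →
                    ∃ λ y → partnerAt (length v) x ≡ just y
partnerAt-defined {v} {a} {b} {c} {w} a<b b<c = λ where
    (inj₁ refl)                → atMedianWindow (inj₁ (inj₁ (a<b , b<c)))
    (inj₂ (inj₁ refl))         → atMedianWindow (inj₁ (inj₂ (a<b , b<c)))
    (inj₂ (inj₂ (inj₁ refl)))  → atMedianWindow (inj₂ (inj₁ (a<b , b<c)))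
    (inj₂ (inj₂ (inj₂ refl)))  → atMedianWindow (inj₂ (inj₂ (a<b , b<c)))
  where
  atMedianWindow : ∀ {x₁ x₂ x₃} → Between x₂ x₁ x₃ ⊎ Between x₁ x₃ x₂ →
           ∃ λ y → partnerAt (length v) (v ++ x₁ ∷ x₂ ∷ x₃ ∷ w) ≡ just y
  atMedianWindow {x₁} {x₂} {x₃} median with pq , e ← neighbours-defined x₁ x₂ x₃ median =
    _ , trans (cong (Maybe._>>= partnerAround) (windowAt-++ v x₁ x₂ x₃ w))
              (cong (Maybe.map (preferredNeighbour v w)) e)

InFour-↭ : ∀ {v a b c w x} → InFour v a b c w x → x ↭ w₁ v a b c w
InFour-↭ {v} {a} {b} {c} = λ where
    (inj₁ refl)               → ↭-refl
    (inj₂ (inj₁ refl))        → ++⁺ˡ v (prep b (swap c a ↭-refl))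
    (inj₂ (inj₂ (inj₁ refl))) → ++⁺ˡ v acb↭bac
    (inj₂ (inj₂ (inj₂ refl))) → ++⁺ˡ v (↭-trans (swap c a ↭-refl) acb↭bac)
  where
  acb↭bac : ∀ {w} → a ∷ c ∷ b ∷ w ↭ b ∷ a ∷ c ∷ w
  acb↭bac = ↭-trans (prep a (swap c b ↭-refl)) (swap a b ↭-refl)

AllowedPair-InFour : ∀ {v a b c w x y} → AllowedPair v a b c w x y →
                     InFour v a b c w x × InFour v a b c w y
AllowedPair-InFour = λ where
  (inj₁ (inj₁ (refl , refl)))               → inj₁ refl , inj₂ (inj₁ refl)
  (inj₁ (inj₂ (refl , refl)))               → inj₂ (inj₁ refl) , inj₁ refl
  (inj₂ (inj₁ (inj₁ (refl , refl))))        → inj₂ (inj₂ (inj₁ refl)) , inj₂ (inj₂ (inj₂ refl))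
  (inj₂ (inj₁ (inj₂ (refl , refl))))        → inj₂ (inj₂ (inj₂ refl)) , inj₂ (inj₂ (inj₁ refl))
  (inj₂ (inj₂ (inj₁ (inj₁ (refl , refl))))) → inj₁ refl , inj₂ (inj₂ (inj₁ refl))
  (inj₂ (inj₂ (inj₁ (inj₂ (refl , refl))))) → inj₂ (inj₂ (inj₁ refl)) , inj₁ refl
  (inj₂ (inj₂ (inj₂ (inj₁ (refl , refl))))) → inj₂ (inj₁ refl) , inj₂ (inj₂ (inj₂ refl))
  (inj₂ (inj₂ (inj₂ (inj₂ (refl , refl))))) → inj₂ (inj₂ (inj₂ refl)) , inj₂ (inj₁ refl)

AllowedPair-↭ : ∀ {v a b c w x y} → AllowedPair v a b c w x y → y ↭ x
AllowedPair-↭ xy with x₄ , y₄ ← AllowedPair-InFour xy = ↭-trans (InFour-↭ y₄) (↭-sym (InFour-↭ x₄))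

-- Membership in Wbar goes through an explicit equation with all arguments given:
-- otherwise Agda compares Wbar with filterᵇ … (S 8) up to conversion, evaluating both.
∈-filterᵇ⁻ : ∀ {A : Set} (p : A → Bool) xs ys → ys ≡ filterᵇ p xs →
             ∀ {x} → x ∈ ys → x ∈ xs × T (p x)
∈-filterᵇ⁻ p xs _ refl = ∈-filter⁻ (T? ∘ p) {xs = xs}

∈-filterᵇ⁺ : ∀ {A : Set} (p : A → Bool) xs ys → ys ≡ filterᵇ p xs →
             ∀ {x} → x ∈ xs → T (p x) → x ∈ ys
∈-filterᵇ⁺ p xs _ refl = ∈-filter⁺ (T? ∘ p) {xs = xs}

Wbar-filter : Wbar ≡ filterᵇ (λ w → not (inWstar w)) (S 8)
Wbar-filter = refl

∈-Wbar⁻ : ∀ {x} → x ∈ Wbar → x ∈ S 8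
∈-Wbar⁻ x∈ = proj₁ (∈-filterᵇ⁻ (λ w → not (inWstar w)) (S 8) Wbar Wbar-filter x∈)

∈-Wbar⁺ : ∀ {x} → x ∈ S 8 → T (not (inWstar x)) → x ∈ Wbar
∈-Wbar⁺ = ∈-filterᵇ⁺ (λ w → not (inWstar w)) (S 8) Wbar Wbar-filter

returnsTo : ℕ → Word → Word → Bool
returnsTo k x y = not (inWstar y) ∧ ⌊ Maybe.≡-dec _≟W_ (partnerAt k y) (just x) ⌋

matched : ℕ → Word → Bool
matched k x = maybe (returnsTo k x) true (partnerAt k x)

-- upTo 6 lists the window positions i ∸ 2 of the colours i = 2, …, 7.
Wbar-matched : All (λ x → T (all (λ k → matched k x) (upTo 6))) Wbar
Wbar-matched = all≡true⇒All (λ x → all (λ k → matched k x) (upTo 6)) Wbar refl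

partnerAt-↭ : ∀ k x {y} → partnerAt k x ≡ just y → y ↭ x
partnerAt-↭ k x e with _ , _ , _ , _ , _ , _ , xy ← partnerAt-allowed k x e = AllowedPair-↭ xy

partnerAt-involutive : ∀ {i x y} → 2 ≤ i → i ≤ 7 → x ∈ Wbar → partnerAt (i ∸ 2) x ≡ just y →
                       y ∈ Wbar × partnerAt (i ∸ 2) y ≡ just x
partnerAt-involutive {i} {x} {y} 2≤i i≤7 x∈ e =
  ∈-Wbar⁺ (∈-S-resp-↭ 8 (partnerAt-↭ k x e) (∈-Wbar⁻ x∈)) (proj₁ returns) ,
  toWitness (proj₂ returns)
  where
  k : ℕ
  k = i ∸ 2
  x-matched : T (matched k x)
  x-matched = All.lookup (all⁺ (λ k → matched k x) (upTo 6) (All.lookup Wbar-matched x∈))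
                         (∈-upTo⁺ (s≤s (∸-monoˡ-≤ 2 i≤7)))
  returns : T (not (inWstar y)) × T ⌊ Maybe.≡-dec _≟W_ (partnerAt k y) (just x) ⌋
  returns = Equivalence.to (T-∧ {not (inWstar y)})
                           (subst (T ∘ maybe (returnsTo k x) true) e x-matched)

Edge : ℕ → Word → Word → Set
Edge i x y = (2 ≤ i × i ≤ 7) × x ∈ Wbar × partnerAt (i ∸ 2) x ≡ just y

Edge-sym : ∀ {i x y} → Edge i x y → Edge i y x
Edge-sym (range@(2≤i , i≤7) , x∈ , e) = range , partnerAt-involutive 2≤i i≤7 x∈ e

Edge-vertices : ∀ {i x y} → Edge i x y → x ∈ Wbar × y ∈ Wbar
Edge-vertices ((2≤i , i≤7) , x∈ , e) = x∈ , proj₁ (partnerAt-involutive 2≤i i≤7 x∈ e)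

Edge-type : ∀ {i x y} → Edge i x y → Σ ℕ λ a → Σ ℕ λ b → Σ ℕ λ c → Σ Word λ v → Σ Word λ w →
                                      Data i a b c v w × AllowedPair v a b c w x y
Edge-type {i} {x} (_ , _ , e) = partnerAt-allowed (i ∸ 2) x e

Edge-unique : ∀ i a b c v w → 2 ≤ i → i ≤ 7 → Data i a b c v w →
              ∀ x → x ∈ Wbar → InFour v a b c w x → Σ Word λ y → Edge i x y × (∀ z → Edge i x z → z ≡ y)
Edge-unique i a b c v w 2≤i i≤7 (a<b , b<c , |v|) x x∈ x₄ =
  y , ((2≤i , i≤7) , x∈ , e) , λ z (_ , _ , e′) → Maybe.just-injective (trans (sym e′) e)
  where
  defined : ∃ λ y → partnerAt (length v) x ≡ just y
  defined = partnerAt-defined a<b b<c x₄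
  y : Word
  y = proj₁ defined
  e : partnerAt (i ∸ 2) x ≡ just y
  e = subst (λ k → partnerAt k x ≡ just y) |v| (proj₂ defined)

D0 : D0Graph 8 Wbar
D0 = record
  { E        = Edge
  ; symm     = Edge-sym
  ; vertices = Edge-vertices
  ; colours  = proj₁
  ; edgeType = Edge-type
  ; unique   = Edge-unique
  }

corollary7p2 : ¬ SchurPositive 8 (Δ 8 Wbar)
               × Σ (D0Graph 8 Wbar) (λ G → ¬ SchurPositive 8 (genFun G))
corollary7p2 = ¬SchurPositive-Δ , D0 , ¬SchurPositive-Δ
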